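{- Let $\mathcal{F}$ be a class of graphs and $d\ge 1$ an integer. The following are equivalent: (i) there exists a constant $c$ such that every $G\in\mathcal{F}$ and every $d$-neighborhood system $\Sigma$ for $G$ with $\rho(\Sigma)=2$ satisfy $\chi(\Sigma)\le c$; (ii) $\mathcal{F}$ is $\sigma$-bounded at depth $d$, i.e. there is a function $f$ such that every $G\in\mathcal{F}$ and every $d$-neighborhood system $\Sigma$ for $G$ satisfy $\chi(\Sigma)\le f(\rho(\Sigma))$.
   Context: Graphs are finite and simple. For a vertex $v$ of $G$, $N^d(v)$ is the set of vertices at distance at most $d$ from $v$, excluding $v$. A $d$-neighborhood system for $G$ is a collection $(\Sigma(v))_{v\in V(G)}$ with $\Sigma(v)\subseteq N^d(v)$; $\rho(\Sigma)=\max_v|\Sigma(v)|$. A $\Sigma$-coloring is a coloring of $V(G)$ in which any two distinct vertices lying together in some $\Sigma(w)$ get different colors, and $\chi(\Sigma)$ is the minimum number of colors of a $\Sigma$-coloring. -}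

module Defs where

open import Data.Nat using (ℕ; zero; suc; _≤_; _⊔_)
open import Data.Bool using (Bool; true; false)
open import Data.Fin using (Fin)
open import Data.Fin.Subset using (Subset; _∈_; ∣_∣)
open import Data.List using (foldr; map; allFin)
open import Data.Product using (Σ; Σ-syntax; ∃; ∃-syntax; _×_)
open import Relation.Binary.PropositionalEquality using (_≡_; _≢_)

record Graph : Set where
  field
    n      : ℕ
    adj    : Fin n → Fin n → Bool
    sym    : ∀ u v → adj u v ≡ adj v u
    irrefl : ∀ v → adj v v ≡ false
open Graph public

data Walk (G : Graph) : ℕ → Fin (n G) → Fin (n G) → Set where
  nil  : ∀ {u} → Walk G 0 u u
  cons : ∀ {k u v w} → adj G u v ≡ true → Walk G k v w → Walk G (suc k) u w

DistLe : (G : Graph) → ℕ → Fin (n G) → Fin (n G) → Set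
DistLe G d u w = ∃[ k ] (k ≤ d × Walk G k u w)

InNbhd : (G : Graph) → ℕ → Fin (n G) → Fin (n G) → Set
InNbhd G d v w = w ≢ v × DistLe G d v w

System : Graph → Set
System G = Fin (n G) → Subset (n G)

IsNbhdSystem : (G : Graph) → ℕ → System G → Set
IsNbhdSystem G d S = ∀ v w → w ∈ S v → InNbhd G d v w

-- ρ(Σ) = max_v |Σ(v)|  (0 on the empty graph)
ρ : (G : Graph) → System G → ℕ
ρ G S = foldr _⊔_ 0 (map (λ v → ∣ S v ∣) (allFin (n G)))

IsΣColoring : (G : Graph) → (S : System G) → {k : ℕ} → (Fin (n G) → Fin k) → Set
IsΣColoring G S c = ∀ w x y → x ∈ S w → y ∈ S w → x ≢ y → c x ≢ c y

χ≤ : (G : Graph) → System G → ℕ → Set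
χ≤ G S k = Σ[ c ∈ (Fin (n G) → Fin k) ] IsΣColoring G S c

module Submission where

-- Proof idea.  (ii) ⇒ (i) is immediate: take c = f 2.  For (i) ⇒ (ii),
-- let c bound χ(Σ) for all systems with ρ(Σ) = 2, and let Σ be an
-- arbitrary d-neighbourhood system with ρ(Σ) = K.  List the members of
-- each Σ(w) as x₀(w), …, x_{|Σ(w)|-1}(w).  For every pair of positions
-- (p , q) ∈ K × K the "pair system" Σₚq(w) = {xₚ(w) , x_q(w)} is again a
-- d-neighbourhood system with all sets of size at most 2, so it has a
-- colouring with c + 1 colours (by (i) if ρ(Σₚq) = 2, trivially otherwise).
-- Any two distinct vertices of some Σ(w) lie together in some Σₚq(w), so
-- the product of these K² colourings is a Σ-colouring with (c+1)^(K²)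
-- colours.

open import Defs
open import Data.Nat using (ℕ; _≤_)
open import Data.Product using (Σ-syntax)
open import Function.Bundles using (_⇔_)
open import Relation.Binary.PropositionalEquality using (_≡_)

open import Data.Nat using (zero; suc; s≤s⁻¹; _+_; _*_; _^_; _<_; _⊔_; z≤n; s≤s)
open import Data.Nat.Properties
  using (≤-trans; ≤-reflexive; ≤∧≢⇒<; ⊔-lub; m≤m⊔n; m≤n⇒m≤o⊔n; n≤1+n; +-suc; +-monoʳ-≤; +-mono-≤; _≟_)
open import Data.Fin as Fin using (Fin; toℕ; fromℕ<; inject≤; combine; remQuot; funToFin; finToFun)
open import Data.Fin.Properties using (inject≤-injective; toℕ-fromℕ<; remQuot-combine; finToFun-funToFin)
open import Data.Fin.Subset using (Subset; _∈_; _⊆_; _∪_; ∣_∣; ⊥; inside; outside; _-_)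
open import Data.Fin.Subset.Properties
  using (∣⊥∣≡0; ∉⊥; x∈p∪q⁻; x∈p∪q⁺; x∈p⇒∣p-x∣<∣p∣; x∈p∧x≢y⇒x∈p-y)
open import Data.Vec using ([]; _∷_; here; there)
open import Data.List using (List; []; _∷_; foldr; map; allFin)
open import Data.List.Relation.Unary.Any using (here; there)
import Data.List.Membership.Propositional as List
open import Data.List.Membership.Propositional.Properties using (∈-allFin)
open import Data.Product using (_,_; proj₁; proj₂; _×_; ∃-syntax)
open import Data.Sum using (inj₁; inj₂)
open import Data.Empty using (⊥-elim)
open import Function.Bundles using (mk⇔)
open import Relation.Binary.PropositionalEquality using (refl; cong; subst; _≢_; module ≡-Reasoning) renaming (sym to ≡-sym)
open import Relation.Nullary using (yes; no; ¬_)

foldr-⊔-ub : ∀ {k} (g : Fin k → ℕ) (xs : List (Fin k)) {v : Fin k} →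
             v List.∈ xs → g v ≤ foldr _⊔_ 0 (map g xs)
foldr-⊔-ub g (x ∷ xs) (here refl) = m≤m⊔n (g x) _
foldr-⊔-ub g (x ∷ xs) (there v∈xs) = m≤n⇒m≤o⊔n (g x) (foldr-⊔-ub g xs v∈xs)

foldr-⊔-lub : ∀ {k} (g : Fin k → ℕ) (xs : List (Fin k)) {m : ℕ} →
              (∀ v → g v ≤ m) → foldr _⊔_ 0 (map g xs) ≤ m
foldr-⊔-lub g [] bound = z≤n
foldr-⊔-lub g (x ∷ xs) bound = ⊔-lub (bound x) (foldr-⊔-lub g xs bound)

ρ-ub : (G : Graph) (S : System G) (v : Fin (n G)) → ∣ S v ∣ ≤ ρ G S
ρ-ub G S v = foldr-⊔-ub (λ u → ∣ S u ∣) (allFin (n G)) (∈-allFin v)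

ρ-lub : (G : Graph) (S : System G) {m : ℕ} → (∀ v → ∣ S v ∣ ≤ m) → ρ G S ≤ m
ρ-lub G S = foldr-⊔-lub (λ u → ∣ S u ∣) (allFin (n G))

-- A subset with two distinct members has size at least 2, since removing
-- them one at a time strictly decreases the size twice.
two-members⇒2≤∣_∣ : ∀ {k} (T : Subset k) {x y : Fin k} →
                    x ∈ T → y ∈ T → x ≢ y → 2 ≤ ∣ T ∣
two-members⇒2≤∣ T ∣ {x} {y} x∈T y∈T x≢y =
  ≤-trans (s≤s (≤-trans (s≤s z≤n) ∣T-x-y∣<∣T-x∣)) ∣T-x∣<∣T∣
  where
  ∣T-x∣<∣T∣ : ∣ T - x ∣ < ∣ T ∣
  ∣T-x∣<∣T∣ = x∈p⇒∣p-x∣<∣p∣ {p = T} x∈T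
  ∣T-x-y∣<∣T-x∣ : ∣ (T - x) - y ∣ < ∣ T - x ∣
  ∣T-x-y∣<∣T-x∣ = x∈p⇒∣p-x∣<∣p∣ {p = T - x} (x∈p∧x≢y⇒x∈p-y y∈T (λ y≡x → x≢y (≡-sym y≡x)))

∣p∪q∣≤∣p∣+∣q∣ : ∀ {k} (p q : Subset k) → ∣ p ∪ q ∣ ≤ ∣ p ∣ + ∣ q ∣
∣p∪q∣≤∣p∣+∣q∣ [] [] = z≤n
∣p∪q∣≤∣p∣+∣q∣ (inside ∷ p) (inside ∷ q) = s≤s (≤-trans (∣p∪q∣≤∣p∣+∣q∣ p q) (+-monoʳ-≤ ∣ p ∣ (n≤1+n ∣ q ∣)))
∣p∪q∣≤∣p∣+∣q∣ (inside ∷ p) (outside ∷ q) = s≤s (∣p∪q∣≤∣p∣+∣q∣ p q)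
∣p∪q∣≤∣p∣+∣q∣ (outside ∷ p) (inside ∷ q) = ≤-trans (s≤s (∣p∪q∣≤∣p∣+∣q∣ p q)) (≤-reflexive (≡-sym (+-suc ∣ p ∣ ∣ q ∣)))
∣p∪q∣≤∣p∣+∣q∣ (outside ∷ p) (outside ∷ q) = ∣p∪q∣≤∣p∣+∣q∣ p q

-- Enumeration of a subset: nth s p is {the p-th member of s} (in increasing
-- order), or ∅ when s has at most p members.
nth : ∀ {k} → Subset k → ℕ → Subset k
nth [] p = []
nth (inside ∷ s) zero = inside ∷ ⊥
nth (inside ∷ s) (suc p) = outside ∷ nth s p
nth (outside ∷ s) p = outside ∷ nth s p

∣nth∣≤1 : ∀ {k} (s : Subset k) (p : ℕ) → ∣ nth s p ∣ ≤ 1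
∣nth∣≤1 [] p = z≤n
∣nth∣≤1 {suc k} (inside ∷ s) zero = s≤s (≤-reflexive (∣⊥∣≡0 k))
∣nth∣≤1 (inside ∷ s) (suc p) = ∣nth∣≤1 s p
∣nth∣≤1 (outside ∷ s) p = ∣nth∣≤1 s p

nth⊆ : ∀ {k} (s : Subset k) (p : ℕ) → nth s p ⊆ s
nth⊆ (inside ∷ s) zero here = here
nth⊆ (inside ∷ s) zero (there x∈⊥) = ⊥-elim (∉⊥ x∈⊥)
nth⊆ (inside ∷ s) (suc p) (there x∈nth) = there (nth⊆ s p x∈nth)
nth⊆ (outside ∷ s) p (there x∈nth) = there (nth⊆ s p x∈nth)

nth-covers : ∀ {k} (s : Subset k) {x : Fin k} → x ∈ s → ∃[ p ] (p < ∣ s ∣ × x ∈ nth s p)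
nth-covers (inside ∷ s) here = 0 , s≤s z≤n , here
nth-covers (inside ∷ s) (there x∈s) with nth-covers s x∈s
... | p , p<∣s∣ , x∈nth = suc p , s≤s p<∣s∣ , there x∈nth
nth-covers (outside ∷ s) (there x∈s) with nth-covers s x∈s
... | p , p<∣s∣ , x∈nth = p , p<∣s∣ , there x∈nth

χ≤-mono : (G : Graph) (S : System G) {k k' : ℕ} → k ≤ k' → χ≤ G S k → χ≤ G S k'
χ≤-mono G S k≤k' (col , valid) =
  (λ x → inject≤ (col x) k≤k') ,
  λ w x y x∈ y∈ x≢y same → valid w x y x∈ y∈ x≢y (inject≤-injective k≤k' k≤k' _ _ same)

χ≤1-of-singletons : (G : Graph) (S : System G) → ρ G S ≤ 1 → χ≤ G S 1
χ≤1-of-singletons G S ρ≤1 =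
  (λ _ → Fin.zero) ,
  λ w x y x∈ y∈ x≢y _ → 2≰1 (≤-trans (two-members⇒2≤∣ S w ∣ x∈ y∈ x≢y) (≤-trans (ρ-ub G S w) ρ≤1))
  where
  2≰1 : ¬ 2 ≤ 1
  2≰1 (s≤s ())

-- A system with all sets of size ≤ 2 is (c+1)-colourable as soon as it is
-- c-colourable in the case ρ = 2, since otherwise ρ ≤ 1.
χ≤-of-ρ≤2 : (G : Graph) (S : System G) {c : ℕ} →
            (ρ G S ≡ 2 → χ≤ G S c) → ρ G S ≤ 2 → χ≤ G S (suc c)
χ≤-of-ρ≤2 G S {c} colour-ρ≡2 ρ≤2 with ρ G S ≟ 2
... | yes ρ≡2 = χ≤-mono G S (n≤1+n c) (colour-ρ≡2 ρ≡2)
... | no ρ≢2 = χ≤-mono G S (s≤s z≤n) (χ≤1-of-singletons G S (s≤s⁻¹ (≤∧≢⇒< ρ≤2 ρ≢2)))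

PairCovering : (G : Graph) (S : System G) {N : ℕ} → (Fin N → System G) → Set
PairCovering G S {N} T =
  ∀ w x y → x ∈ S w → y ∈ S w → x ≢ y → ∃[ i ] (x ∈ T i w × y ∈ T i w)

productColouring : (G : Graph) (S : System G) {N k : ℕ} (T : Fin N → System G) →
                   (∀ i → χ≤ G (T i) k) → PairCovering G S T → χ≤ G S (k ^ N)
productColouring G S {N} {k} T colourings covering = tuple , valid
  where
  colour : ∀ i → Fin (n G) → Fin k
  colour i = proj₁ (colourings i)
  tuple : Fin (n G) → Fin (k ^ N)
  tuple x = funToFin (λ i → colour i x)
  valid : IsΣColoring G S tuple
  valid w x y x∈ y∈ x≢y same with covering w x y x∈ y∈ x≢y
  ... | i , x∈Tᵢ , y∈Tᵢ = proj₂ (colourings i) w x y x∈Tᵢ y∈Tᵢ x≢y (begin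
    colour i x                    ≡⟨ finToFun-funToFin (λ j → colour j x) i ⟨
    finToFun (tuple x) i          ≡⟨ cong (λ t → finToFun t i) same ⟩
    finToFun (tuple y) i          ≡⟨ finToFun-funToFin (λ j → colour j y) i ⟩
    colour i y                    ∎)
    where open ≡-Reasoning

pairSystem : (G : Graph) → System G → ℕ → ℕ → System G
pairSystem G S p q w = nth (S w) p ∪ nth (S w) q

pairSystem⊆ : (G : Graph) (S : System G) (p q : ℕ) (w : Fin (n G)) → pairSystem G S p q w ⊆ S w
pairSystem⊆ G S p q w x∈ with x∈p∪q⁻ (nth (S w) p) (nth (S w) q) x∈
... | inj₁ x∈nth = nth⊆ (S w) p x∈nth
... | inj₂ x∈nth = nth⊆ (S w) q x∈nth

pairSystem-nbhd : (G : Graph) (d : ℕ) (S : System G) (p q : ℕ) →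
                  IsNbhdSystem G d S → IsNbhdSystem G d (pairSystem G S p q)
pairSystem-nbhd G d S p q nbhd v w w∈ = nbhd v w (pairSystem⊆ G S p q v w∈)

ρ-pairSystem≤2 : (G : Graph) (S : System G) (p q : ℕ) → ρ G (pairSystem G S p q) ≤ 2
ρ-pairSystem≤2 G S p q = ρ-lub G (pairSystem G S p q) λ w →
  ≤-trans (∣p∪q∣≤∣p∣+∣q∣ (nth (S w) p) (nth (S w) q)) (+-mono-≤ (∣nth∣≤1 (S w) p) (∣nth∣≤1 (S w) q))

-- All pair systems for positions below K, indexed by Fin (K * K) ≅ Fin K × Fin K.
pairFamily : (G : Graph) → System G → (K : ℕ) → Fin (K * K) → System G
pairFamily G S K i = pairSystem G S (toℕ (proj₁ (remQuot {K} K i))) (toℕ (proj₂ (remQuot {K} K i)))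

pairFamily-combine : (G : Graph) (S : System G) {K : ℕ} (p q : Fin K) →
                     pairFamily G S K (combine p q) ≡ pairSystem G S (toℕ p) (toℕ q)
pairFamily-combine G S p q =
  cong (λ pq → pairSystem G S (toℕ (proj₁ pq)) (toℕ (proj₂ pq))) (remQuot-combine p q)

pairFamily-covers : (G : Graph) (S : System G) (K : ℕ) →
                    (∀ w → ∣ S w ∣ ≤ K) → PairCovering G S (pairFamily G S K)
pairFamily-covers G S K ∣S∣≤K w x y x∈ y∈ _ with position x∈ | position y∈
  where
  position : ∀ {z} → z ∈ S w → Σ[ p ∈ Fin K ] (z ∈ nth (S w) (toℕ p))
  position {z} z∈ with nth-covers (S w) z∈
  ... | p , p<∣S∣ , z∈nth = fromℕ< p<K , subst (λ r → z ∈ nth (S w) r) (≡-sym (toℕ-fromℕ< p<K)) z∈nth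
    where
    p<K : p < K
    p<K = ≤-trans p<∣S∣ (∣S∣≤K w)
... | p , x∈nth | q , y∈nth =
  combine p q ,
  subst (λ T → x ∈ T w) (≡-sym (pairFamily-combine G S p q)) (x∈p∪q⁺ (inj₁ x∈nth)) ,
  subst (λ T → y ∈ T w) (≡-sym (pairFamily-combine G S p q)) (x∈p∪q⁺ {p = nth (S w) (toℕ p)} (inj₂ y∈nth))

mainTheorem10 : (F : Graph → Set) (d : ℕ) → 1 ≤ d →
    (Σ[ c ∈ ℕ ] (∀ (G : Graph) → F G → (S : System G) → IsNbhdSystem G d S → ρ G S ≡ 2 → χ≤ G S c))
    ⇔ (Σ[ f ∈ (ℕ → ℕ) ] (∀ (G : Graph) → F G → (S : System G) → IsNbhdSystem G d S → χ≤ G S (f (ρ G S))))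
mainTheorem10 F d _ = mk⇔ σ-bounded specialise
  where
  BoundedAtPairs : Set
  BoundedAtPairs = Σ[ c ∈ ℕ ] (∀ G → F G → (S : System G) → IsNbhdSystem G d S → ρ G S ≡ 2 → χ≤ G S c)
  SigmaBounded : Set
  SigmaBounded = Σ[ f ∈ (ℕ → ℕ) ] (∀ G → F G → (S : System G) → IsNbhdSystem G d S → χ≤ G S (f (ρ G S)))

  σ-bounded : BoundedAtPairs → SigmaBounded
  σ-bounded (c , bounded₂) = (λ K → suc c ^ (K * K)) , λ G FG S nbhd →
    let T = pairFamily G S (ρ G S)
        colourT : ∀ i → χ≤ G (T i) (suc c)
        colourT i = χ≤-of-ρ≤2 G (T i) (bounded₂ G FG (T i) (pairSystem-nbhd G d S _ _ nbhd))
                                      (ρ-pairSystem≤2 G S _ _)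
    in productColouring G S T colourT (pairFamily-covers G S (ρ G S) (ρ-ub G S))

  specialise : SigmaBounded → BoundedAtPairs
  specialise (f , bounded) = f 2 , λ G FG S nbhd ρ≡2 → subst (χ≤ G S) (cong f ρ≡2) (bounded G FG S nbhd)
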